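{- Let $G=(V,E)$ be a graph and $q\ge 2$ an integer, and let $c_q=\sum_{i=0}^{q}q^i=\frac{q^{q+1}-1}{q-1}$. For any $0<\alpha<1$, let $V_\alpha=\{v\in V: r(v)\ge\alpha\}$. Then $|V_\alpha|\le c_q/\alpha$.
   Context: Graphs are simple and undirected with $V=[n]$. $q$-random BFS ($q$-RBFS) from a vertex $v$: - Initialize a queue containing $v$ with level $0$, and $H=(\{v\},\emptyset)$. - Repeatedly pop a vertex $u$ and sample $q$ neighbors $s_{u,1},\dots,s_{u,q}$ of $u$, each independently and uniformly at random. Add each $s_{u,i}$ and each edge $\{u,s_{u,i}\}$ to $H$. - Enqueue $s_{u,i}$ with level $\ell(u)+1$ if $\ell(u)<q-1$ and $s_{u,i}$ has not been enqueued before. - Stop when the queue is empty and return $H$ (undirected, without parallel edges). The reach probability $r(v)=r_q(v)$ of a vertex $v$ is the probability that a $q$-RBFS started at a uniformly random vertex of $V$ reaches (includes) $v$. -}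

module Defs where

open import Data.Bool using (Bool; true; false; T; T?; if_then_else_; not; _∧_)
open import Data.Nat as ℕ using (ℕ; zero; suc; _^_)
open import Data.Fin as Fin using (Fin)
open import Data.List using (List; []; _∷_; _++_; [_]; map; filter; concatMap; length; allFin; upTo; foldr)
open import Data.Nat.ListAction using (sum)
open import Data.Product using (_×_; _,_)
open import Data.Integer using (+_)
open import Data.Rational using (ℚ; 0ℚ; 1ℚ; _+_; _*_; _/_; _≤?_)
open import Relation.Binary.PropositionalEquality using (_≡_)
open import Relation.Nullary.Decidable using (does)

record Graph (N : ℕ) : Set where
  field
    adj    : Fin N → Fin N → Bool
    adj-sym    : ∀ u v → adj u v ≡ adj v u
    adj-irrefl : ∀ u → adj u u ≡ false
open Graph public

nbrs : ∀ {N} → Graph N → Fin N → List (Fin N)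
nbrs G u = filter (λ w → T? (adj G u w)) (allFin _)

-- all ordered k-tuples of elements of xs (as lists); each is one equally likely
-- outcome of k independent uniform samples from xs
tuples : ∀ {A : Set} → ℕ → List A → List (List A)
tuples zero    xs = [] ∷ []
tuples (suc k) xs = concatMap (λ x → map (x ∷_) (tuples k xs)) xs

sumℚ : List ℚ → ℚ
sumℚ = foldr _+_ 0ℚ

-- uniform average of a list of rationals (average of [] is 0, never used)
avg : List ℚ → ℚ
avg []       = 0ℚ
avg (x ∷ xs) = sumℚ (x ∷ xs) * ((+ 1) / suc (length xs))

insert : ∀ {N} → Fin N → (Fin N → Bool) → (Fin N → Bool)
insert s S w = does (w Fin.≟ s) Data.Bool.∨ S w
  where import Data.Bool

-- State of the q-RBFS: queue of (vertex, level), set of enqueued vertices,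
-- vertex set of H.
record State (N : ℕ) : Set where
  constructor st
  field
    queue : List (Fin N × ℕ)
    enq   : Fin N → Bool
    inH   : Fin N → Bool

processSamples : ∀ {N} → (q ℓ : ℕ) → List (Fin N) → State N → State N
processSamples q ℓ []       σ = σ
processSamples q ℓ (s ∷ ss) (st Q E H) =
  processSamples q ℓ ss
    (if does (suc ℓ ℕ.<? q) ∧ not (E s)
     then st (Q ++ [ (s , suc ℓ) ]) (insert s E) (insert s H)
     else st Q E (insert s H))

indicator : Bool → ℚ
indicator true  = 1ℚ
indicator false = 0ℚ

-- Probability that the remaining run of the q-RBFS from state σ ends with v ∈ H.
-- `fuel` bounds the number of pops (each vertex is enqueued at most once, so N
-- pops always suffice).
reachFrom : ∀ {N} → Graph N → (q : ℕ) → (v : Fin N) → (fuel : ℕ) → State N → ℚ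
reachFrom G q v zero       σ = indicator (State.inH σ v)
reachFrom G q v (suc fuel) (st [] E H) = indicator (H v)
reachFrom G q v (suc fuel) (st ((u , ℓ) ∷ Q) E H) with nbrs G u
... | []       = reachFrom G q v fuel (st Q E H)
... | (x ∷ xs) =
  avg (map (λ ss → reachFrom G q v fuel (processSamples q ℓ ss (st Q E H)))
           (tuples q (x ∷ xs)))

initState : ∀ {N} → Fin N → State N
initState w = st [ (w , 0) ] (insert w (λ _ → false)) (insert w (λ _ → false))

reachFromVertex : ∀ {N} → Graph N → ℕ → Fin N → Fin N → ℚ
reachFromVertex {N} G q w v = reachFrom G q v N (initState w)

reachProb : ∀ {N} → Graph N → ℕ → Fin N → ℚ
reachProb {N} G q v = avg (map (λ w → reachFromVertex G q w v) (allFin N))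

c : ℕ → ℕ
c q = sum (map (q ^_) (upTo (suc q)))

cardVα : ∀ {N} → Graph N → ℕ → ℚ → ℕ
cardVα {N} G q α = length (filter (λ v → α ≤? reachProb G q v) (allFin N))

-- Along every run of the q-RBFS the quantity |H| + Σ_{(u,ℓ) queued} (q + q² + … + q^(q-ℓ))
-- never increases: popping a vertex of level ℓ adds at most q vertices to H and enqueues
-- at most q vertices of level ℓ+1, and q (1 + q + … + q^(q-ℓ-1)) = q + … + q^(q-ℓ).
-- Initially it is 1 + q + … + q^q = c_q, so |H| ≤ c_q for every outcome. Hence
-- Σ_v r(v), the expected size of H, is at most c_q, and counting the vertices with
-- r(v) ≥ α gives |V_α| α ≤ c_q.
module Submission where

open import Defs
open import Data.Nat using (ℕ; suc; _≤_)
open import Data.Integer using (+_)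
open import Data.Rational using (ℚ; 0ℚ; 1ℚ; _<_; _/_; _÷_; >-nonZero)
open import Data.Rational using () renaming (_≤_ to _≤ℚ_)

open import Data.Bool using (Bool; true; false; if_then_else_; not; _∧_)
open import Data.Fin using (Fin; zero; suc)
open import Data.List using (List; []; _∷_; _++_; [_]; map; filter; length; allFin; applyUpTo; upTo)
import Data.List.Properties as List
open import Data.List.Relation.Unary.All as All using (All; []; _∷_)
import Data.List.Relation.Unary.All.Properties as All
open import Data.Nat as ℕ using (zero; _+_; _*_; _∸_; _^_; z≤n; s≤s)
import Data.Nat.Properties as ℕ
open import Data.Nat.ListAction using (sum)
import Data.Nat.ListAction.Properties as ℕ
open import Data.Nat.Coprimality as Coprime using ()
open import Data.Nat.Tactic.RingSolver using (solve-∀)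
import Data.Integer as ℤ
import Data.Integer.Properties as ℤ
import Data.Rational as ℚ
import Data.Rational.Properties as ℚ
open import Algebra.Bundles using (CommutativeMonoid)
open import Algebra.Properties.CommutativeSemigroup
  (CommutativeMonoid.commutativeSemigroup ℚ.+-0-commutativeMonoid) using (interchange)
open import Data.Product using (_×_; _,_; proj₂)
open import Function using (_∘_)
open import Relation.Binary.PropositionalEquality hiding ([_])
open import Relation.Nullary using (yes; no; does; proof; ofʸ; ofⁿ)

fromℕ : ℕ → ℚ
fromℕ n = + n / 1

fromℕ≡mkℚ : ∀ n → fromℕ n ≡ ℚ.mkℚ (+ n) 0 (Coprime.sym (Coprime.1-coprimeTo n))
fromℕ≡mkℚ n = ℚ.normalize-coprime (Coprime.sym (Coprime.1-coprimeTo n))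

fromℕ-+ : ∀ m n → fromℕ (m + n) ≡ fromℕ m ℚ.+ fromℕ n
fromℕ-+ m n rewrite fromℕ≡mkℚ m | fromℕ≡mkℚ n =
  trans (fromℕ≡mkℚ (m + n))
        (sym (trans (cong (_/ 1) (cong₂ ℤ._+_ (ℤ.*-identityʳ (+ m)) (ℤ.*-identityʳ (+ n))))
                    (fromℕ≡mkℚ (m + n))))

fromℕ-mono-≤ : ∀ {m n} → m ≤ n → fromℕ m ≤ℚ fromℕ n
fromℕ-mono-≤ {m} {n} m≤n rewrite fromℕ≡mkℚ m | fromℕ≡mkℚ n =
  ℚ.*≤* (subst₂ ℤ._≤_ (sym (ℤ.*-identityʳ (+ m))) (sym (ℤ.*-identityʳ (+ n))) (ℤ.+≤+ m≤n))

fromℕ-nonNeg : ∀ n → 0ℚ ≤ℚ fromℕ n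
fromℕ-nonNeg n = fromℕ-mono-≤ {0} {n} z≤n

fromℕ-suc-* : ∀ n p → fromℕ (suc n) ℚ.* p ≡ p ℚ.+ fromℕ n ℚ.* p
fromℕ-suc-* n p = begin
  fromℕ (1 + n) ℚ.* p               ≡⟨ cong (ℚ._* p) (fromℕ-+ 1 n) ⟩
  (1ℚ ℚ.+ fromℕ n) ℚ.* p            ≡⟨ ℚ.*-distribʳ-+ p 1ℚ (fromℕ n) ⟩
  1ℚ ℚ.* p ℚ.+ fromℕ n ℚ.* p        ≡⟨ cong (ℚ._+ fromℕ n ℚ.* p) (ℚ.*-identityˡ p) ⟩
  p ℚ.+ fromℕ n ℚ.* p               ∎
  where open ≡-Reasoning

fromℕ-*-inverseʳ : ∀ n → fromℕ (suc n) ℚ.* (+ 1 / suc n) ≡ 1ℚ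
fromℕ-*-inverseʳ n =
  trans (cong₂ ℚ._*_ (fromℕ≡mkℚ (suc n)) (ℚ.normalize-coprime (Coprime.1-coprimeTo (suc n))))
        (ℚ.*-inverseʳ (ℚ.mkℚ (+ suc n) 0 (Coprime.sym (Coprime.1-coprimeTo (suc n)))))

*≤⇒≤÷ : ∀ {p q} r .{{_ : ℚ.Positive r}} → p ℚ.* r ≤ℚ q → p ≤ℚ (q ÷ r) {{ℚ.pos⇒nonZero r}}
*≤⇒≤÷ {p} {q} r pr≤q = begin
  p                        ≡⟨ sym (ℚ.*-identityʳ p) ⟩
  p ℚ.* 1ℚ                 ≡⟨ cong (p ℚ.*_) (sym (ℚ.*-inverseʳ r)) ⟩
  p ℚ.* (r ℚ.* ℚ.1/ r)     ≡⟨ sym (ℚ.*-assoc p r (ℚ.1/ r)) ⟩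
  p ℚ.* r ℚ.* ℚ.1/ r       ≤⟨ ℚ.*-monoʳ-≤-nonNeg (ℚ.1/ r) {{1/r-nonNeg}} pr≤q ⟩
  q ℚ.* ℚ.1/ r             ∎
  where
  open ℚ.≤-Reasoning
  instance
    r-nonZero : ℚ.NonZero r
    r-nonZero = ℚ.pos⇒nonZero r
  1/r-nonNeg : ℚ.NonNegative (ℚ.1/ r)
  1/r-nonNeg = ℚ.pos⇒nonNeg (ℚ.1/ r) {{ℚ.1/pos⇒pos r}}

module _ {A : Set} where

  sumℚ-map-0 : (xs : List A) → sumℚ (map (λ _ → 0ℚ) xs) ≡ 0ℚ
  sumℚ-map-0 []       = refl
  sumℚ-map-0 (x ∷ xs) = trans (ℚ.+-identityˡ _) (sumℚ-map-0 xs)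

  sumℚ-map-+ : ∀ (f g : A → ℚ) xs →
    sumℚ (map (λ x → f x ℚ.+ g x) xs) ≡ sumℚ (map f xs) ℚ.+ sumℚ (map g xs)
  sumℚ-map-+ f g []       = refl
  sumℚ-map-+ f g (x ∷ xs) =
    trans (cong (f x ℚ.+ g x ℚ.+_) (sumℚ-map-+ f g xs)) (interchange (f x) (g x) _ _)

  sumℚ-map-*ʳ : ∀ (f : A → ℚ) p xs → sumℚ (map (λ x → f x ℚ.* p) xs) ≡ sumℚ (map f xs) ℚ.* p
  sumℚ-map-*ʳ f p []       = sym (ℚ.*-zeroˡ p)
  sumℚ-map-*ʳ f p (x ∷ xs) =
    trans (cong (f x ℚ.* p ℚ.+_) (sumℚ-map-*ʳ f p xs)) (sym (ℚ.*-distribʳ-+ p (f x) _))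

  sumℚ-map-≤ : ∀ (f : A → ℚ) b {xs} → All (λ x → f x ≤ℚ b) xs →
    sumℚ (map f xs) ≤ℚ fromℕ (length xs) ℚ.* b
  sumℚ-map-≤ f b []                   = ℚ.≤-reflexive (sym (ℚ.*-zeroˡ b))
  sumℚ-map-≤ f b {_ ∷ xs} (fx≤b ∷ ps) =
    ℚ.≤-trans (ℚ.+-mono-≤ fx≤b (sumℚ-map-≤ f b ps))
              (ℚ.≤-reflexive (sym (fromℕ-suc-* (length xs) b)))

  sumℚ-map-nonNeg : ∀ (f : A → ℚ) {xs} → All (λ x → 0ℚ ≤ℚ f x) xs → 0ℚ ≤ℚ sumℚ (map f xs)
  sumℚ-map-nonNeg f []         = ℚ.≤-refl
  sumℚ-map-nonNeg f (p ∷ ps)   = ℚ.+-mono-≤ p (sumℚ-map-nonNeg f ps)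

  avg-map-∷ : ∀ (f : A → ℚ) x xs →
    avg (map f (x ∷ xs)) ≡ sumℚ (map f (x ∷ xs)) ℚ.* (+ 1 / suc (length xs))
  avg-map-∷ f x xs = cong (λ n → sumℚ (map f (x ∷ xs)) ℚ.* (+ 1 / suc n)) (List.length-map f xs)

  avg-map-≤ : ∀ (f : A → ℚ) b {xs} → 0ℚ ≤ℚ b → All (λ x → f x ≤ℚ b) xs → avg (map f xs) ≤ℚ b
  avg-map-≤ f b {[]}     0≤b _  = 0≤b
  avg-map-≤ f b {x ∷ xs} _   ps = begin
    avg (map f (x ∷ xs))                       ≡⟨ avg-map-∷ f x xs ⟩
    sumℚ (map f (x ∷ xs)) ℚ.* k                ≤⟨ ℚ.*-monoʳ-≤-nonNeg k {{k-nonNeg}} (sumℚ-map-≤ f b ps) ⟩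
    fromℕ (suc (length xs)) ℚ.* b ℚ.* k        ≡⟨ cong (ℚ._* k) (ℚ.*-comm (fromℕ (suc (length xs))) b) ⟩
    b ℚ.* fromℕ (suc (length xs)) ℚ.* k        ≡⟨ ℚ.*-assoc b _ k ⟩
    b ℚ.* (fromℕ (suc (length xs)) ℚ.* k)      ≡⟨ cong (b ℚ.*_) (fromℕ-*-inverseʳ (length xs)) ⟩
    b ℚ.* 1ℚ                                   ≡⟨ ℚ.*-identityʳ b ⟩
    b                                          ∎
    where
    open ℚ.≤-Reasoning
    k = + 1 / suc (length xs)
    k-nonNeg = ℚ.normalize-nonNeg 1 (suc (length xs))

  avg-map-nonNeg : ∀ (f : A → ℚ) {xs} → All (λ x → 0ℚ ≤ℚ f x) xs → 0ℚ ≤ℚ avg (map f xs)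
  avg-map-nonNeg f {[]}     _  = ℚ.≤-refl
  avg-map-nonNeg f {x ∷ xs} ps = begin
    0ℚ                              ≡⟨ sym (ℚ.*-zeroˡ k) ⟩
    0ℚ ℚ.* k                        ≤⟨ ℚ.*-monoʳ-≤-nonNeg k {{k-nonNeg}} (sumℚ-map-nonNeg f ps) ⟩
    sumℚ (map f (x ∷ xs)) ℚ.* k     ≡⟨ sym (avg-map-∷ f x xs) ⟩
    avg (map f (x ∷ xs))            ∎
    where
    open ℚ.≤-Reasoning
    k = + 1 / suc (length xs)
    k-nonNeg = ℚ.normalize-nonNeg 1 (suc (length xs))

  length-filter-*≤sumℚ : ∀ (f : A → ℚ) α {xs} → All (λ x → 0ℚ ≤ℚ f x) xs →
    fromℕ (length (filter (λ x → α ℚ.≤? f x) xs)) ℚ.* α ≤ℚ sumℚ (map f xs)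
  length-filter-*≤sumℚ f α []                  = ℚ.≤-reflexive (ℚ.*-zeroˡ α)
  length-filter-*≤sumℚ f α {x ∷ xs} (0≤fx ∷ ps) with α ℚ.≤? f x
  ... | yes α≤fx = begin
    fromℕ (length (filter α≤? (x ∷ xs))) ℚ.* α  ≡⟨ cong (λ ys → fromℕ (length ys) ℚ.* α) (List.filter-accept α≤? α≤fx) ⟩
    fromℕ (suc (length (filter α≤? xs))) ℚ.* α  ≡⟨ fromℕ-suc-* (length (filter α≤? xs)) α ⟩
    α ℚ.+ fromℕ (length (filter α≤? xs)) ℚ.* α  ≤⟨ ℚ.+-mono-≤ α≤fx (length-filter-*≤sumℚ f α ps) ⟩
    f x ℚ.+ sumℚ (map f xs)                     ∎
    where
    open ℚ.≤-Reasoning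
    α≤? = λ x → α ℚ.≤? f x
  ... | no α≰fx = begin
    fromℕ (length (filter α≤? (x ∷ xs))) ℚ.* α  ≡⟨ cong (λ ys → fromℕ (length ys) ℚ.* α) (List.filter-reject α≤? α≰fx) ⟩
    fromℕ (length (filter α≤? xs)) ℚ.* α        ≡⟨ ℚ.+-identityˡ _ ⟨
    0ℚ ℚ.+ fromℕ (length (filter α≤? xs)) ℚ.* α ≤⟨ ℚ.+-mono-≤ 0≤fx (length-filter-*≤sumℚ f α ps) ⟩
    f x ℚ.+ sumℚ (map f xs)                     ∎
    where
    open ℚ.≤-Reasoning
    α≤? = λ x → α ℚ.≤? f x

sumℚ-map-comm : ∀ {A B : Set} (g : A → B → ℚ) xs ys →
  sumℚ (map (λ x → sumℚ (map (g x) ys)) xs) ≡ sumℚ (map (λ y → sumℚ (map (λ x → g x y) xs)) ys)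
sumℚ-map-comm g []       ys = sym (sumℚ-map-0 ys)
sumℚ-map-comm g (x ∷ xs) ys =
  trans (cong (sumℚ (map (g x) ys) ℚ.+_) (sumℚ-map-comm g xs ys))
        (sym (sumℚ-map-+ (g x) (λ y → sumℚ (map (λ x → g x y) xs)) ys))

sumℚ-avg-comm : ∀ {A B : Set} (g : A → B → ℚ) xs ys →
  sumℚ (map (λ x → avg (map (g x) ys)) xs) ≡ avg (map (λ y → sumℚ (map (λ x → g x y) xs)) ys)
sumℚ-avg-comm g xs []       = sumℚ-map-0 xs
sumℚ-avg-comm g xs (y ∷ ys) = begin
  sumℚ (map (λ x → avg (map (g x) (y ∷ ys))) xs)
    ≡⟨ cong sumℚ (List.map-cong (λ x → avg-map-∷ (g x) y ys) xs) ⟩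
  sumℚ (map (λ x → sumℚ (map (g x) (y ∷ ys)) ℚ.* k) xs)
    ≡⟨ sumℚ-map-*ʳ (λ x → sumℚ (map (g x) (y ∷ ys))) k xs ⟩
  sumℚ (map (λ x → sumℚ (map (g x) (y ∷ ys))) xs) ℚ.* k
    ≡⟨ cong (ℚ._* k) (sumℚ-map-comm g xs (y ∷ ys)) ⟩
  sumℚ (map (λ y → sumℚ (map (λ x → g x y) xs)) (y ∷ ys)) ℚ.* k
    ≡⟨ sym (avg-map-∷ (λ y → sumℚ (map (λ x → g x y) xs)) y ys) ⟩
  avg (map (λ y → sumℚ (map (λ x → g x y) xs)) (y ∷ ys)) ∎
  where
  open ≡-Reasoning
  k = + 1 / suc (length ys)

sumℚ-map-allFin-suc : ∀ n (f : Fin (suc n) → ℚ) →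
  sumℚ (map f (allFin (suc n))) ≡ f zero ℚ.+ sumℚ (map (f ∘ suc) (allFin n))
sumℚ-map-allFin-suc n f = cong (λ xs → f zero ℚ.+ sumℚ xs)
  (trans (List.map-tabulate suc f) (sym (List.map-tabulate (λ i → i) (f ∘ suc))))

size : ∀ {n} → (Fin n → Bool) → ℕ
size {zero}  S = 0
size {suc n} S = (if S zero then 1 else 0) + size (S ∘ suc)

size-∅ : ∀ n → size {n} (λ _ → false) ≡ 0
size-∅ zero    = refl
size-∅ (suc n) = size-∅ n

size-insert : ∀ {n} (s : Fin n) (S : Fin n → Bool) → size (insert s S) ≤ suc (size S)
size-insert zero    S = s≤s (ℕ.m≤n+m _ (if S zero then 1 else 0))
size-insert (suc s) S with S zero
... | true  = s≤s (size-insert s (S ∘ suc))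
... | false = size-insert s (S ∘ suc)

fromℕ-indicator : ∀ b → indicator b ≡ fromℕ (if b then 1 else 0)
fromℕ-indicator true  = refl
fromℕ-indicator false = refl

indicator-nonNeg : ∀ b → 0ℚ ≤ℚ indicator b
indicator-nonNeg true  = fromℕ-nonNeg 1
indicator-nonNeg false = ℚ.≤-refl

sumℚ-indicator : ∀ n (S : Fin n → Bool) →
  sumℚ (map (λ v → indicator (S v)) (allFin n)) ≡ fromℕ (size S)
sumℚ-indicator zero    S = refl
sumℚ-indicator (suc n) S =
  trans (sumℚ-map-allFin-suc n (λ v → indicator (S v)))
        (trans (cong₂ ℚ._+_ (fromℕ-indicator (S zero)) (sumℚ-indicator n (S ∘ suc)))
               (sym (fromℕ-+ (if S zero then 1 else 0) (size (S ∘ suc)))))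

sum-applyUpTo-*ˡ : ∀ m (f : ℕ → ℕ) k → sum (applyUpTo (λ i → m * f i) k) ≡ m * sum (applyUpTo f k)
sum-applyUpTo-*ˡ m f zero    = sym (ℕ.*-zeroʳ m)
sum-applyUpTo-*ˡ m f (suc k) =
  trans (cong (_+_ (m * f 0)) (sum-applyUpTo-*ˡ m (f ∘ suc) k)) (sym (ℕ.*-distribˡ-+ m (f 0) _))

sum-powers-suc : ∀ q k → sum (map (q ^_) (upTo (suc k))) ≡ 1 + q * sum (map (q ^_) (upTo k))
sum-powers-suc q k = begin
  sum (map (q ^_) (upTo (suc k)))                 ≡⟨ cong sum (List.map-upTo (q ^_) (suc k)) ⟩
  1 + sum (applyUpTo (λ i → q * q ^ i) k)         ≡⟨ cong suc (sum-applyUpTo-*ˡ q (q ^_) k) ⟩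
  1 + q * sum (applyUpTo (q ^_) k)                ≡⟨ cong (λ xs → 1 + q * sum xs) (List.map-upTo (q ^_) k) ⟨
  1 + q * sum (map (q ^_) (upTo k))               ∎
  where open ≡-Reasoning

tuples-length : ∀ {A : Set} k (xs : List A) → All (λ ys → length ys ≡ k) (tuples k xs)
tuples-length zero    xs = refl ∷ []
tuples-length (suc k) xs = All.concat⁺ (All.map⁺ (All.universal prepend xs))
  where
  prepend : ∀ x → All (λ ys → length ys ≡ suc k) (map (x ∷_) (tuples k xs))
  prepend x = All.map⁺ (All.map (cong suc) (tuples-length k xs))

module Potential (q : ℕ) where

  -- q + q² + … + q^(k+1): the most vertices that a queued vertex with k further levels
  -- below it can, together with its descendants, add to H.
  depthBound : ℕ → ℕ
  depthBound zero    = q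
  depthBound (suc k) = q * suc (depthBound k)

  weight : ℕ → ℕ
  weight ℓ = depthBound (q ∸ suc ℓ)

  childWeight : ℕ → ℕ
  childWeight ℓ = if does (suc ℓ ℕ.<? q) then weight (suc ℓ) else 0

  weight-unfold : ∀ ℓ → q * suc (childWeight ℓ) ≡ weight ℓ
  weight-unfold ℓ with does (suc ℓ ℕ.<? q) | proof (suc ℓ ℕ.<? q)
  ... | true  | ofʸ ℓ+1<q = cong depthBound (sym (ℕ.+-∸-assoc 1 ℓ+1<q))
  ... | false | ofⁿ ℓ+1≮q = trans (ℕ.*-identityʳ q)
                                  (cong depthBound (sym (ℕ.m≤n⇒m∸n≡0 (ℕ.≮⇒≥ ℓ+1≮q))))

  suc-depthBound : ∀ k → suc (depthBound k) ≡ sum (map (q ^_) (upTo (suc (suc k))))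
  suc-depthBound zero    = sym (trans (sum-powers-suc q 1) (cong suc (ℕ.*-identityʳ q)))
  suc-depthBound (suc k) =
    trans (cong (λ m → suc (q * m)) (suc-depthBound k)) (sym (sum-powers-suc q (suc (suc k))))

  module _ {N : ℕ} where

    queueWeight : List (Fin N × ℕ) → ℕ
    queueWeight Q = sum (map (weight ∘ proj₂) Q)

    potential : State N → ℕ
    potential (st Q E H) = size H + queueWeight Q

    -- processSamples q ℓ is definitionally the left fold of this step.
    sampleStep : ℕ → Fin N → State N → State N
    sampleStep ℓ s (st Q E H) =
      if does (suc ℓ ℕ.<? q) ∧ not (E s)
      then st (Q ++ [ (s , suc ℓ) ]) (insert s E) (insert s H)
      else st Q E (insert s H)

    potential-sampleStep : ∀ ℓ s σ → potential (sampleStep ℓ s σ) ≤ suc (potential σ + childWeight ℓ)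
    potential-sampleStep ℓ s (st Q E H) with does (suc ℓ ℕ.<? q) | E s
    ... | true  | false = begin
      size (insert s H) + queueWeight (Q ++ [ (s , suc ℓ) ])
        ≡⟨ cong (_+_ (size (insert s H))) (trans (cong sum (List.map-++ (weight ∘ proj₂) Q _))
                                              (ℕ.sum-++ (map (weight ∘ proj₂) Q) _)) ⟩
      size (insert s H) + (queueWeight Q + (weight (suc ℓ) + 0))
        ≤⟨ ℕ.+-monoˡ-≤ _ (size-insert s H) ⟩
      suc (size H) + (queueWeight Q + (weight (suc ℓ) + 0))
        ≡⟨ rearrange (size H) (queueWeight Q) (weight (suc ℓ)) ⟩
      suc (size H + queueWeight Q + weight (suc ℓ)) ∎
      where
      open ℕ.≤-Reasoning
      rearrange : ∀ a b c → suc a + (b + (c + 0)) ≡ suc (a + b + c)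
      rearrange = solve-∀
    ... | true  | true  = ℕ.≤-trans (ℕ.+-monoˡ-≤ _ (size-insert s H)) (s≤s (ℕ.m≤m+n _ _))
    ... | false | _     = ℕ.≤-trans (ℕ.+-monoˡ-≤ _ (size-insert s H)) (s≤s (ℕ.m≤m+n _ _))

    potential-processSamples : ∀ ℓ ss σ →
      potential (processSamples q ℓ ss σ) ≤ potential σ + length ss * suc (childWeight ℓ)
    potential-processSamples ℓ []       σ = ℕ.m≤m+n _ 0
    potential-processSamples ℓ (s ∷ ss) σ = begin
      potential (processSamples q ℓ ss (sampleStep ℓ s σ))
        ≤⟨ potential-processSamples ℓ ss (sampleStep ℓ s σ) ⟩
      potential (sampleStep ℓ s σ) + length ss * suc (childWeight ℓ)
        ≤⟨ ℕ.+-monoˡ-≤ _ (potential-sampleStep ℓ s σ) ⟩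
      suc (potential σ + childWeight ℓ) + length ss * suc (childWeight ℓ)
        ≡⟨ rearrange (potential σ) (childWeight ℓ) (length ss) ⟩
      potential σ + suc (length ss) * suc (childWeight ℓ) ∎
      where
      open ℕ.≤-Reasoning
      rearrange : ∀ p c n → suc (p + c) + n * suc c ≡ p + suc n * suc c
      rearrange = solve-∀

    potential-pop : ∀ u ℓ Q E H ss → length ss ≡ q →
      potential (processSamples q ℓ ss (st Q E H)) ≤ potential (st ((u , ℓ) ∷ Q) E H)
    potential-pop u ℓ Q E H ss refl = begin
      potential (processSamples q ℓ ss (st Q E H))
        ≤⟨ potential-processSamples ℓ ss (st Q E H) ⟩
      size H + queueWeight Q + q * suc (childWeight ℓ)
        ≡⟨ cong (_+_ (size H + queueWeight Q)) (weight-unfold ℓ) ⟩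
      size H + queueWeight Q + weight ℓ
        ≡⟨ rearrange (size H) (queueWeight Q) (weight ℓ) ⟩
      size H + (weight ℓ + queueWeight Q) ∎
      where
      open ℕ.≤-Reasoning
      rearrange : ∀ a b c → a + b + c ≡ a + (c + b)
      rearrange = solve-∀

    potential-drop : ∀ u ℓ Q E H → potential (st Q E H) ≤ potential (st ((u , ℓ) ∷ Q) E H)
    potential-drop u ℓ Q E H = ℕ.+-monoʳ-≤ (size H) (ℕ.m≤n+m (queueWeight Q) (weight ℓ))

    sumℚ-inH≤potential : ∀ σ →
      sumℚ (map (λ v → indicator (State.inH σ v)) (allFin N)) ≤ℚ fromℕ (potential σ)
    sumℚ-inH≤potential (st Q E H) =
      ℚ.≤-trans (ℚ.≤-reflexive (sumℚ-indicator N H)) (fromℕ-mono-≤ (ℕ.m≤m+n (size H) _))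

potential-initState≤c : ∀ k {N} (w : Fin N) → Potential.potential (suc k) (initState w) ≤ c (suc k)
potential-initState≤c k {N} w = begin
  size (insert w (λ _ → false)) + (depthBound k + 0)
    ≤⟨ ℕ.+-monoˡ-≤ _ (ℕ.≤-trans (size-insert w (λ _ → false)) (s≤s (ℕ.≤-reflexive (size-∅ N)))) ⟩
  1 + (depthBound k + 0)
    ≡⟨ cong suc (ℕ.+-identityʳ (depthBound k)) ⟩
  suc (depthBound k)
    ≡⟨ suc-depthBound k ⟩
  c (suc k) ∎
  where
  open ℕ.≤-Reasoning
  open Potential (suc k)

module _ {N : ℕ} (G : Graph N) (q : ℕ) where
  open Potential q

  sumℚ-reachFrom≤potential : ∀ fuel σ →
    sumℚ (map (λ v → reachFrom G q v fuel σ) (allFin N)) ≤ℚ fromℕ (potential σ)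
  sumℚ-reachFrom≤potential zero       σ           = sumℚ-inH≤potential σ
  sumℚ-reachFrom≤potential (suc fuel) (st [] E H) = sumℚ-inH≤potential (st [] E H)
  sumℚ-reachFrom≤potential (suc fuel) (st ((u , ℓ) ∷ Q) E H) with nbrs G u
  ... | []     = ℚ.≤-trans (sumℚ-reachFrom≤potential fuel (st Q E H))
                           (fromℕ-mono-≤ (potential-drop u ℓ Q E H))
  ... | x ∷ xs = begin
    sumℚ (map (λ v → avg (map (run v) samples)) (allFin N))
      ≡⟨ sumℚ-avg-comm run (allFin N) samples ⟩
    avg (map (λ ss → sumℚ (map (λ v → run v ss) (allFin N))) samples)
      ≤⟨ avg-map-≤ _ _ (fromℕ-nonNeg (potential (st ((u , ℓ) ∷ Q) E H)))
                       (All.map (λ {ss} → run≤potential ss) (tuples-length q (x ∷ xs))) ⟩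
    fromℕ (potential (st ((u , ℓ) ∷ Q) E H)) ∎
    where
    open ℚ.≤-Reasoning
    samples = tuples q (x ∷ xs)
    run : Fin N → List (Fin N) → ℚ
    run v ss = reachFrom G q v fuel (processSamples q ℓ ss (st Q E H))
    run≤potential : ∀ ss → length ss ≡ q →
      sumℚ (map (λ v → run v ss) (allFin N)) ≤ℚ fromℕ (potential (st ((u , ℓ) ∷ Q) E H))
    run≤potential ss ∣ss∣≡q =
      ℚ.≤-trans (sumℚ-reachFrom≤potential fuel (processSamples q ℓ ss (st Q E H)))
                (fromℕ-mono-≤ (potential-pop u ℓ Q E H ss ∣ss∣≡q))

  reachFrom-nonNeg : ∀ v fuel σ → 0ℚ ≤ℚ reachFrom G q v fuel σ
  reachFrom-nonNeg v zero       σ           = indicator-nonNeg (State.inH σ v)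
  reachFrom-nonNeg v (suc fuel) (st [] E H) = indicator-nonNeg (H v)
  reachFrom-nonNeg v (suc fuel) (st ((u , ℓ) ∷ Q) E H) with nbrs G u
  ... | []     = reachFrom-nonNeg v fuel (st Q E H)
  ... | x ∷ xs = avg-map-nonNeg _ (All.universal (λ _ → reachFrom-nonNeg v fuel _) (tuples q (x ∷ xs)))

  sumℚ-reachProb≤c : 1 ≤ q → sumℚ (map (reachProb G q) (allFin N)) ≤ℚ fromℕ (c q)
  sumℚ-reachProb≤c (s≤s {n = k} _) = begin
    sumℚ (map (λ v → avg (map (λ w → reachFromVertex G q w v) (allFin N))) (allFin N))
      ≡⟨ sumℚ-avg-comm (λ v w → reachFromVertex G q w v) (allFin N) (allFin N) ⟩
    avg (map (λ w → sumℚ (map (reachFromVertex G q w) (allFin N))) (allFin N))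
      ≤⟨ avg-map-≤ _ _ (fromℕ-nonNeg (c q))
           (All.universal (λ w → ℚ.≤-trans (sumℚ-reachFrom≤potential N (initState w))
                                           (fromℕ-mono-≤ (potential-initState≤c k w)))
                          (allFin N)) ⟩
    fromℕ (c q) ∎
    where open ℚ.≤-Reasoning

  reachProb-nonNeg : ∀ v → 0ℚ ≤ℚ reachProb G q v
  reachProb-nonNeg v = avg-map-nonNeg _ (All.universal (λ w → reachFrom-nonNeg v N (initState w)) (allFin N))

lemma3p7 : ∀ {n : ℕ} (G : Graph (suc n)) (q : ℕ) → 2 ≤ q →
    (α : ℚ) → (0<α : 0ℚ < α) → α < 1ℚ →
    ((+ cardVα G q α) / 1) ≤ℚ (((+ c q) / 1) ÷ α) {{>-nonZero 0<α}}
lemma3p7 {n} G q 2≤q α 0<α _ = *≤⇒≤÷ α (begin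
  fromℕ (cardVα G q α) ℚ.* α                   ≤⟨ length-filter-*≤sumℚ (reachProb G q) α
                                                     (All.universal (reachProb-nonNeg G q) (allFin (suc n))) ⟩
  sumℚ (map (reachProb G q) (allFin (suc n)))  ≤⟨ sumℚ-reachProb≤c G q (ℕ.≤-trans (s≤s z≤n) 2≤q) ⟩
  fromℕ (c q)                                  ∎)
  where
  open ℚ.≤-Reasoning
  instance
    α-positive : ℚ.Positive α
    α-positive = ℚ.positive 0<α
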